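{- Let $n\geq 1$ and consider the uniform distribution on the set of all ordered preference sets of length $n$. Then the mean of the number of flaws is $\frac{2^{2n-1}}{\binom{2n}{n}}-1$ and its variance is $n-\left[\frac{2^{2n-1}}{\binom{2n}{n}}\right]^2$.
   Context: Parking model: $n$ parking spaces numbered $1,\dots,n$ from left to right; a preference set of length $n$ is a sequence $(a_1,\dots,a_n)$ with $a_i\in[n]$. Cars arrive in order; car $i$ goes to space $a_i$, and if it is occupied, moves to the first unoccupied space to the right; if there is none, the car cannot park. The number of flaws is the number of cars that cannot park. A preference set is ordered if $a_1\leq\cdots\leq a_n$. -}

module Defs where

open import Data.Nat as ℕ using (ℕ; zero; suc)
open import Data.Bool using (Bool; true; false; if_then_else_)
open import Data.Maybe using (Maybe; just; nothing)
import Data.Maybe as Maybe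
open import Data.Fin using (Fin; toℕ)
open import Data.Vec using (Vec; []; _∷_; replicate)
open import Data.List using (List; []; _∷_; map; concatMap; filter; length; foldr)
open import Data.List.Base using (allFin)
open import Data.Integer using (+_)
open import Data.Rational using (ℚ; _/_; _+_; _*_; _-_; 0ℚ)
open import Relation.Nullary using (Dec; yes; no; ¬_)
open import Relation.Unary using (Decidable)
open import Data.Product using (_×_; _,_)
open import Data.Unit using (⊤; tt)

-- A preference set of length n: car i (0-based index in the vector) prefers
-- space (toℕ a_i + 1); i.e. Fin n encodes [n] shifted by one.
PrefSet : ℕ → Set
PrefSet n = Vec (Fin n) n

allVecs : (n k : ℕ) → List (Vec (Fin n) k)
allVecs n zero    = [] ∷ []
allVecs n (suc k) = concatMap (λ a → map (a ∷_) (allVecs n k)) (allFin n)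

Ordered : ∀ {n k} → Vec (Fin n) k → Set
Ordered []               = ⊤
Ordered (a ∷ [])         = ⊤
Ordered (a ∷ (b ∷ v))    = (toℕ a ℕ.≤ toℕ b) × Ordered (b ∷ v)

ordered? : ∀ {n k} → Decidable (Ordered {n} {k})
ordered? []          = yes tt
ordered? (a ∷ [])    = yes tt
ordered? (a ∷ b ∷ v) with toℕ a ℕ.≤? toℕ b | ordered? (b ∷ v)
... | yes p | yes q = yes (p , q)
... | no ¬p | _     = no λ { (p , _) → ¬p p }
... | yes _ | no ¬q = no λ { (_ , q) → ¬q q }

orderedPrefSets : (n : ℕ) → List (PrefSet n)
orderedPrefSets n = filter ordered? (allVecs n n)

-- Occupancy of the n spaces (true = occupied).  `place k occ` parks a car
-- preferring the (k+1)-st space: it takes the first unoccupied space at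
-- position ≥ k (0-based); nothing if there is none (car cannot park).
place : ∀ {m} → ℕ → Vec Bool m → Maybe (Vec Bool m)
place zero    []          = nothing
place zero    (true ∷ v)  = Maybe.map (true ∷_) (place zero v)
place zero    (false ∷ v) = just (true ∷ v)
place (suc k) []          = nothing
place (suc k) (b ∷ v)     = Maybe.map (b ∷_) (place k v)

runFlaws : ∀ {n k} → Vec Bool n → Vec (Fin n) k → ℕ
runFlaws occ []      = 0
runFlaws occ (a ∷ as) with place (toℕ a) occ
... | just occ' = runFlaws occ' as
... | nothing   = suc (runFlaws occ as)

flaws : ∀ {n} → PrefSet n → ℕ
flaws {n} = runFlaws (replicate n false)

-- rational number a/b for naturals (b = 0 ↦ 0; only used with b ≠ 0)
_/ℕ_ : ℕ → ℕ → ℚ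
a /ℕ zero  = 0ℚ
a /ℕ suc b = (+ a) / suc b

fromℕ : ℕ → ℚ
fromℕ a = a /ℕ 1

sumℚ : List ℚ → ℚ
sumℚ = foldr _+_ 0ℚ

mean : List ℚ → ℚ
mean xs = sumℚ xs * (1 /ℕ length xs)

variance : List ℚ → ℚ
variance xs = mean (map (λ x → (x - μ) * (x - μ)) xs)
  where μ = mean xs

-- the random variable "number of flaws" under the uniform distribution on
-- ordered preference sets of length n, listed over its sample space
flawValues : ℕ → List ℚ
flawValues n = map (λ p → fromℕ (flaws p)) (orderedPrefSets n)

module Submission where

-- In an ordered preference set the cars arrive in increasing order of preference, so when the
-- first car preferring a space ≥ m arrives, the spaces from m on form a block of occupied
-- spaces followed by free ones. Counting the sorted continuations by the sizes of these two
-- blocks gives a Pascal-type recursion, whose solution shows that exactly C(2n-1, n+j) ordered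
-- preference sets of length n have at least j flaws. The first two moments are sums of these
-- tail counts with weights 1 and 2j - 1. Together with the total C(2n-1, n), the first sum is
-- half of row 2n-1 of Pascal's triangle; the second telescopes once the weight is absorbed
-- into the binomial coefficient.

module Sums where

  open import Data.Nat using (ℕ; zero; suc; _+_; _*_; _∸_; _≤_; _<_; _≤ᵇ_; s≤s; z≤n; pred)
  open import Data.Nat.Properties
  open import Data.Nat.Tactic.RingSolver using (solve-∀)
  open import Algebra.Properties.CommutativeSemigroup +-commutativeSemigroup using (interchange)
  open import Data.Bool using (true; false; if_then_else_)
  open import Data.Fin as Fin using (toℕ)
  open import Data.List using (List; []; _∷_; _++_; map; concatMap; filter; length; tabulate; allFin)
  open import Data.List.Properties using (map-tabulate)
  open import Relation.Nullary using (does)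
  open import Relation.Unary using (Decidable)
  open import Relation.Binary.PropositionalEquality
  open ≡-Reasoning

  private variable
    A B : Set

  infixl 10 ∑ ∑<

  ∑ : List A → (A → ℕ) → ℕ
  ∑ []       f = 0
  ∑ (x ∷ xs) f = f x + ∑ xs f

  syntax ∑ xs (λ x → e) = ∑[ x ∈ xs ] e

  ∑< : ℕ → (ℕ → ℕ) → ℕ
  ∑< zero    f = 0
  ∑< (suc n) f = f 0 + ∑< n (λ i → f (suc i))

  syntax ∑< n (λ i → e) = ∑[ i < n ] e

  ∑-cong : ∀ (xs : List A) {f g : A → ℕ} → (∀ x → f x ≡ g x) → ∑ xs f ≡ ∑ xs g
  ∑-cong []       f≗g = refl
  ∑-cong (x ∷ xs) f≗g = cong₂ _+_ (f≗g x) (∑-cong xs f≗g)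

  ∑-map : ∀ (g : A → B) (xs : List A) (f : B → ℕ) → ∑[ y ∈ map g xs ] f y ≡ ∑[ x ∈ xs ] f (g x)
  ∑-map g []       f = refl
  ∑-map g (x ∷ xs) f = cong (f (g x) +_) (∑-map g xs f)

  ∑-++ : ∀ (xs ys : List A) (f : A → ℕ) → ∑ (xs ++ ys) f ≡ ∑ xs f + ∑ ys f
  ∑-++ []       ys f = refl
  ∑-++ (x ∷ xs) ys f = trans (cong (f x +_) (∑-++ xs ys f)) (sym (+-assoc (f x) _ _))

  ∑-concatMap : ∀ (g : A → List B) (xs : List A) (f : B → ℕ) →
                ∑[ y ∈ concatMap g xs ] f y ≡ ∑[ x ∈ xs ] ∑[ y ∈ g x ] f y
  ∑-concatMap g []       f = refl
  ∑-concatMap g (x ∷ xs) f = trans (∑-++ (g x) _ f) (cong (∑ (g x) f +_) (∑-concatMap g xs f))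

  ∑-*ˡ : ∀ (xs : List A) c (f : A → ℕ) → ∑[ x ∈ xs ] (c * f x) ≡ c * ∑ xs f
  ∑-*ˡ []       c f = sym (*-zeroʳ c)
  ∑-*ˡ (x ∷ xs) c f = trans (cong (c * f x +_) (∑-*ˡ xs c f)) (sym (*-distribˡ-+ c (f x) _))

  ∑-if : ∀ (xs : List A) b (f : A → ℕ) → ∑[ x ∈ xs ] (if b then f x else 0) ≡ (if b then ∑ xs f else 0)
  ∑-if xs       true  f = refl
  ∑-if []       false f = refl
  ∑-if (x ∷ xs) false f = ∑-if xs false f

  ∑-filter : ∀ {P : A → Set} (P? : Decidable P) (xs : List A) (f : A → ℕ) →
             ∑ (filter P? xs) f ≡ ∑[ x ∈ xs ] (if does (P? x) then f x else 0)
  ∑-filter P? []       f = refl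
  ∑-filter P? (x ∷ xs) f with does (P? x)
  ... | true  = cong (f x +_) (∑-filter P? xs f)
  ... | false = ∑-filter P? xs f

  length≡∑1 : (xs : List A) → length xs ≡ ∑[ x ∈ xs ] 1
  length≡∑1 []       = refl
  length≡∑1 (x ∷ xs) = cong suc (length≡∑1 xs)

  ∑<-zero : ∀ n → ∑[ i < n ] 0 ≡ 0
  ∑<-zero zero    = refl
  ∑<-zero (suc n) = ∑<-zero n

  ∑<-cong : ∀ n {f g : ℕ → ℕ} → (∀ i → i < n → f i ≡ g i) → ∑< n f ≡ ∑< n g
  ∑<-cong zero    f≗g = refl
  ∑<-cong (suc n) f≗g = cong₂ _+_ (f≗g 0 (s≤s z≤n)) (∑<-cong n (λ i i<n → f≗g (suc i) (s≤s i<n)))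

  ∑<-+ : ∀ n (f g : ℕ → ℕ) → ∑[ i < n ] (f i + g i) ≡ ∑< n f + ∑< n g
  ∑<-+ zero    f g = refl
  ∑<-+ (suc n) f g = trans (cong (f 0 + g 0 +_) (∑<-+ n _ _)) (interchange (f 0) (g 0) _ _)

  ∑<-*ˡ : ∀ n c (f : ℕ → ℕ) → ∑[ i < n ] (c * f i) ≡ c * ∑< n f
  ∑<-*ˡ zero    c f = sym (*-zeroʳ c)
  ∑<-*ˡ (suc n) c f = trans (cong (c * f 0 +_) (∑<-*ˡ n c _)) (sym (*-distribˡ-+ c (f 0) _))

  ∑<-snoc : ∀ n (f : ℕ → ℕ) → ∑< (suc n) f ≡ ∑< n f + f n
  ∑<-snoc zero    f = +-comm (f 0) 0
  ∑<-snoc (suc n) f = trans (cong (f 0 +_) (∑<-snoc n _)) (sym (+-assoc (f 0) _ _))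

  ∑<-split : ∀ a b (f : ℕ → ℕ) → ∑< (a + b) f ≡ ∑< a f + ∑[ i < b ] f (a + i)
  ∑<-split zero    b f = refl
  ∑<-split (suc a) b f = trans (cong (f 0 +_) (∑<-split a b _)) (sym (+-assoc (f 0) _ _))

  ∑<-reverse : ∀ n (f : ℕ → ℕ) → ∑[ i < n ] f (n ∸ suc i) ≡ ∑< n f
  ∑<-reverse zero    f = refl
  ∑<-reverse (suc n) f = begin
    f n + ∑[ i < n ] f (n ∸ suc i)  ≡⟨ cong (f n +_) (∑<-reverse n f) ⟩
    f n + ∑< n f                    ≡⟨ +-comm (f n) _ ⟩
    ∑< n f + f n                    ≡⟨ ∑<-snoc n f ⟨
    ∑< (suc n) f                    ∎

  ∑<-telescope : ∀ n (t a : ℕ → ℕ) → (∀ i → i < n → t i + a (suc i) ≡ a i) → ∑< n t + a n ≡ a 0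
  ∑<-telescope zero    t a step = refl
  ∑<-telescope (suc n) t a step = begin
    t 0 + ∑[ i < n ] t (suc i) + a (suc n)    ≡⟨ +-assoc (t 0) _ _ ⟩
    t 0 + (∑[ i < n ] t (suc i) + a (suc n))  ≡⟨ cong (t 0 +_) (∑<-telescope n (λ i → t (suc i)) (λ i → a (suc i))
                                                                             (λ i i<n → step (suc i) (s≤s i<n))) ⟩
    t 0 + a 1                                 ≡⟨ step 0 (s≤s z≤n) ⟩
    a 0                                       ∎

  ∑-∑<-comm : ∀ (xs : List A) n (f : A → ℕ → ℕ) → ∑[ x ∈ xs ] ∑[ i < n ] f x i ≡ ∑[ i < n ] ∑[ x ∈ xs ] f x i
  ∑-∑<-comm []       n f = sym (∑<-zero n)
  ∑-∑<-comm (x ∷ xs) n f = trans (cong (∑< n (f x) +_) (∑-∑<-comm xs n f)) (sym (∑<-+ n _ _))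

  ∑-allFin : ∀ n (h : ℕ → ℕ) → ∑[ a ∈ allFin n ] h (toℕ a) ≡ ∑< n h
  ∑-allFin zero    h = refl
  ∑-allFin (suc n) h = cong (h 0 +_) (begin
    ∑[ a ∈ tabulate (Fin.suc {n}) ] h (toℕ a)
      ≡⟨ cong (λ as → ∑[ a ∈ as ] h (toℕ a)) (map-tabulate {n = n} (λ a → a) Fin.suc) ⟨
    ∑[ a ∈ map Fin.suc (allFin n) ] h (toℕ a)
      ≡⟨ ∑-map Fin.suc (allFin n) (λ a → h (toℕ a)) ⟩
    ∑[ a ∈ allFin n ] h (suc (toℕ a))
      ≡⟨ ∑-allFin n (λ i → h (suc i)) ⟩
    ∑[ i < n ] h (suc i) ∎)

  ≤ᵇ-suc : ∀ m n → (suc m ≤ᵇ suc n) ≡ (m ≤ᵇ n)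
  ≤ᵇ-suc zero    n = refl
  ≤ᵇ-suc (suc m) n = refl

  ∑<-from : ∀ n m (f : ℕ → ℕ) → ∑[ i < n ] (if m ≤ᵇ i then f i else 0) ≡ ∑[ i < n ∸ m ] f (m + i)
  ∑<-from n       zero    f = refl
  ∑<-from zero    (suc m) f = refl
  ∑<-from (suc n) (suc m) f = begin
    ∑[ i < n ] (if suc m ≤ᵇ suc i then f (suc i) else 0)
      ≡⟨ ∑<-cong n (λ i _ → cong (λ b → if b then f (suc i) else 0) (≤ᵇ-suc m i)) ⟩
    ∑[ i < n ] (if m ≤ᵇ i then f (suc i) else 0)
      ≡⟨ ∑<-from n m (λ i → f (suc i)) ⟩
    ∑[ i < n ∸ m ] f (suc m + i) ∎

  atLeast : ℕ → ℕ → ℕ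
  atLeast j x = if j ≤ᵇ x then 1 else 0

  atLeast-suc : ∀ j x → atLeast j (suc x) ≡ atLeast (pred j) x
  atLeast-suc zero    x = refl
  atLeast-suc (suc j) x = cong (λ b → if b then 1 else 0) (≤ᵇ-suc j x)

  ∑<-atLeast : ∀ K x (h : ℕ → ℕ) → x ≤ K → ∑[ i < K ] (h i * atLeast (suc i) x) ≡ ∑< x h
  ∑<-atLeast K       zero    h _ = trans (∑<-cong K (λ i _ → *-zeroʳ (h i))) (∑<-zero K)
  ∑<-atLeast (suc K) (suc x) h (s≤s x≤K) =
    cong₂ _+_ (*-identityʳ (h 0))
      (trans (∑<-cong K (λ i _ → cong (h (suc i) *_) (atLeast-suc (suc (suc i)) x)))
             (∑<-atLeast K x (λ i → h (suc i)) x≤K))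

  ∑-layers : ∀ (xs : List A) (f : A → ℕ) K (h : ℕ → ℕ) → (∀ x → f x ≤ K) →
             ∑[ x ∈ xs ] ∑< (f x) h ≡ ∑[ i < K ] (h i * ∑[ x ∈ xs ] atLeast (suc i) (f x))
  ∑-layers xs f K h f≤K = begin
    ∑[ x ∈ xs ] ∑< (f x) h                                ≡⟨ ∑-cong xs (λ x → ∑<-atLeast K (f x) h (f≤K x)) ⟨
    ∑[ x ∈ xs ] ∑[ i < K ] (h i * atLeast (suc i) (f x))  ≡⟨ ∑-∑<-comm xs K (λ x i → h i * atLeast (suc i) (f x)) ⟩
    ∑[ i < K ] ∑[ x ∈ xs ] (h i * atLeast (suc i) (f x))  ≡⟨ ∑<-cong K (λ i _ → ∑-*ˡ xs (h i) _) ⟩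
    ∑[ i < K ] (h i * ∑[ x ∈ xs ] atLeast (suc i) (f x))  ∎

  ∑<-one : ∀ x → ∑[ i < x ] 1 ≡ x
  ∑<-one zero    = refl
  ∑<-one (suc x) = cong suc (∑<-one x)

  ∑<-odd : ∀ x → ∑[ i < x ] (1 + 2 * i) ≡ x * x
  ∑<-odd zero    = refl
  ∑<-odd (suc x) = begin
    ∑[ i < suc x ] (1 + 2 * i)            ≡⟨ ∑<-snoc x (λ i → 1 + 2 * i) ⟩
    ∑[ i < x ] (1 + 2 * i) + (1 + 2 * x)  ≡⟨ cong (_+ (1 + 2 * x)) (∑<-odd x) ⟩
    x * x + (1 + 2 * x)                   ≡⟨ square-suc x ⟩
    suc x * suc x                         ∎
    where
    square-suc : ∀ x → x * x + (1 + 2 * x) ≡ suc x * suc x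
    square-suc = solve-∀

module Parking where

  open import Defs
  open Sums
  open import Data.Nat using (ℕ; zero; suc; _+_; _∸_; _≤_; _≤ᵇ_; z≤n; s≤s; pred)
  open import Data.Nat.Properties
    using (≤ᵇ⇒≤; ≤⇒≤ᵇ; +-identityʳ; +-suc; m+n∸m≡n; m≤n⇒m≤1+n; pred[m∸n]≡m∸[1+n])
  open import Data.Bool using (Bool; true; false; T; _∧_; if_then_else_)
  open import Data.Bool.Properties using (T-∧)
  open import Data.Maybe as Maybe using (Maybe; just; nothing)
  open import Data.Fin using (Fin; toℕ)
  open import Data.Vec using (Vec; []; _∷_; replicate)
  open import Data.List using (map; concatMap; allFin)
  open import Data.Product using (∃; _×_; _,_)
  open import Data.Unit using (tt)
  open import Function using (_⇔_; mk⇔; Equivalence)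
  open import Relation.Nullary using (does)
  open import Relation.Nullary.Decidable using (T?; does-⇔)
  open import Relation.Binary.PropositionalEquality
  open ≡-Reasoning

  private variable
    l m q r : ℕ
    occ : Vec Bool l

  -- Layout m q r occ: after the first m spaces come q occupied spaces and then r free ones.
  data Layout : ∀ {l} → ℕ → ℕ → ℕ → Vec Bool l → Set where
    []    : Layout 0 0 0 []
    free  : ∀ {l r} {v : Vec Bool l} → Layout 0 0 r v → Layout 0 0 (suc r) (false ∷ v)
    taken : ∀ {l q r} {v : Vec Bool l} → Layout 0 q r v → Layout 0 (suc q) r (true ∷ v)
    skip  : ∀ {l m q r b} {v : Vec Bool l} → Layout m q r v → Layout (suc m) q r (b ∷ v)

  Layout-length : Layout {l} m q r occ → l ≡ m + (q + r)
  Layout-length []        = refl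
  Layout-length (free L)  = cong suc (Layout-length L)
  Layout-length (taken L) = cong suc (Layout-length L)
  Layout-length (skip L)  = cong suc (Layout-length L)

  Layout-∸ : Layout {l} m q r occ → l ∸ m ≡ q + r
  Layout-∸ {m = m} L = trans (cong (_∸ m) (Layout-length L)) (m+n∸m≡n m _)

  Layout-empty : ∀ l → Layout 0 0 l (replicate l false)
  Layout-empty zero    = []
  Layout-empty (suc l) = free (Layout-empty l)

  skip-taken : Layout m (suc q) r occ → Layout (suc m) q r occ
  skip-taken (taken L) = skip L
  skip-taken (skip L)  = skip (skip-taken L)

  skip-free : Layout m 0 (suc r) occ → Layout (suc m) 0 r occ
  skip-free (free L) = skip L
  skip-free (skip L) = skip (skip-free L)

  place-free : Layout m q (suc r) occ → ∃ λ occ′ → place m occ ≡ just occ′ × Layout m (suc q) r occ′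
  place-free (free {v = v} L) = true ∷ v , refl , taken L
  place-free (taken L) with place-free L
  ... | occ′ , eq , L′ = true ∷ occ′ , cong (Maybe.map (true ∷_)) eq , taken L′
  place-free (skip {b = b} L) with place-free L
  ... | occ′ , eq , L′ = b ∷ occ′ , cong (Maybe.map (b ∷_)) eq , skip L′

  place-full : Layout m q 0 occ → place m occ ≡ nothing
  place-full []        = refl
  place-full (taken L) = cong (Maybe.map (true ∷_)) (place-full L)
  place-full (skip L)  = cong (Maybe.map _) (place-full L)

  flawsAfter : ∀ {n k} → Maybe (Vec Bool n) → Vec Bool n → Vec (Fin n) k → ℕ
  flawsAfter (just occ′) occ as = runFlaws occ′ as
  flawsAfter nothing     occ as = suc (runFlaws occ as)

  runFlaws-∷ : ∀ {n k} (occ : Vec Bool n) a (as : Vec (Fin n) k) →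
               runFlaws occ (a ∷ as) ≡ flawsAfter (place (toℕ a) occ) occ as
  runFlaws-∷ occ a as with place (toℕ a) occ
  ... | just _  = refl
  ... | nothing = refl

  runFlaws-≤ : ∀ {n k} (occ : Vec Bool n) (as : Vec (Fin n) k) → runFlaws occ as ≤ k
  runFlaws-≤ occ []       = z≤n
  runFlaws-≤ occ (a ∷ as) rewrite runFlaws-∷ occ a as with place (toℕ a) occ
  ... | just occ′ = m≤n⇒m≤1+n (runFlaws-≤ occ′ as)
  ... | nothing   = s≤s (runFlaws-≤ occ as)

  sortedFrom : ∀ {n k} → ℕ → Vec (Fin n) k → Bool
  sortedFrom m []       = true
  sortedFrom m (a ∷ as) = (m ≤ᵇ toℕ a) ∧ sortedFrom (toℕ a) as

  Ordered⇔sortedFrom : ∀ {n k} (a : Fin n) (as : Vec (Fin n) k) → Ordered (a ∷ as) ⇔ T (sortedFrom (toℕ a) as)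
  Ordered⇔sortedFrom a []       = mk⇔ (λ _ → tt) (λ _ → tt)
  Ordered⇔sortedFrom a (b ∷ bs) = mk⇔
    (λ (a≤b , ordered) → Equivalence.from T-∧ (≤⇒≤ᵇ a≤b , Equivalence.to (Ordered⇔sortedFrom b bs) ordered))
    (λ t → let (a≤ᵇb , sorted) = Equivalence.to T-∧ t
           in ≤ᵇ⇒≤ _ _ a≤ᵇb , Equivalence.from (Ordered⇔sortedFrom b bs) sorted)

  does-ordered? : ∀ {n k} (as : Vec (Fin n) k) → does (ordered? as) ≡ sortedFrom 0 as
  does-ordered? []       = refl
  does-ordered? (a ∷ as) = does-⇔ (Ordered⇔sortedFrom a as) (ordered? (a ∷ as)) (T? _)

  -- flawTail k r q j counts the sorted preference sequences of k cars for r + q spaces, the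
  -- first q of them already occupied, that produce at least j flaws.
  flawTail : ℕ → ℕ → ℕ → ℕ → ℕ
  flawTail zero    r       q       j = atLeast j 0
  flawTail (suc k) zero    zero    j = 0
  flawTail (suc k) (suc r) zero    j = flawTail k r 1 j + flawTail (suc k) r 0 j
  flawTail (suc k) (suc r) (suc q) j = flawTail k r (suc (suc q)) j + flawTail (suc k) (suc r) q j
  flawTail (suc k) zero    (suc q) j = flawTail k 0 (suc q) (pred j) + flawTail (suc k) 0 q j

  module Simulation (n : ℕ) where

    #flaws≥ : ℕ → ℕ → Vec Bool n → ℕ → ℕ
    #flaws≥ k m occ j = ∑[ as ∈ allVecs n k ] (if sortedFrom m as then atLeast j (runFlaws occ as) else 0)

    #flaws≥-after : ℕ → ℕ → Vec Bool n → ℕ → ℕ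
    #flaws≥-after k a occ j =
      ∑[ as ∈ allVecs n k ] (if sortedFrom a as then atLeast j (flawsAfter (place a occ) occ as) else 0)

    #flaws≥-suc : ∀ k m occ j → #flaws≥ (suc k) m occ j ≡ ∑[ i < n ∸ m ] #flaws≥-after k (m + i) occ j
    #flaws≥-suc k m occ j = begin
      ∑[ as ∈ concatMap (λ a → map (a ∷_) (allVecs n k)) (allFin n) ] F as
        ≡⟨ ∑-concatMap _ (allFin n) F ⟩
      ∑[ a ∈ allFin n ] ∑[ as ∈ map (a ∷_) (allVecs n k) ] F as
        ≡⟨ ∑-cong (allFin n) (λ a → ∑-map (a ∷_) (allVecs n k) F) ⟩
      ∑[ a ∈ allFin n ] ∑[ as ∈ allVecs n k ] F (a ∷ as)
        ≡⟨ ∑-cong (allFin n) (λ a → trans (∑-cong (allVecs n k) (first-car a)) (∑-if (allVecs n k) (m ≤ᵇ toℕ a) _)) ⟩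
      ∑[ a ∈ allFin n ] (if m ≤ᵇ toℕ a then #flaws≥-after k (toℕ a) occ j else 0)
        ≡⟨ ∑-allFin n (λ a → if m ≤ᵇ a then #flaws≥-after k a occ j else 0) ⟩
      ∑[ i < n ] (if m ≤ᵇ i then #flaws≥-after k i occ j else 0)
        ≡⟨ ∑<-from n m (λ a → #flaws≥-after k a occ j) ⟩
      ∑[ i < n ∸ m ] #flaws≥-after k (m + i) occ j ∎
      where
      F : Vec (Fin n) (suc k) → ℕ
      F as = if sortedFrom m as then atLeast j (runFlaws occ as) else 0
      first-car : ∀ a as → F (a ∷ as) ≡
        (if m ≤ᵇ toℕ a then (if sortedFrom (toℕ a) as then atLeast j (flawsAfter (place (toℕ a) occ) occ as) else 0) else 0)
      first-car a as with m ≤ᵇ toℕ a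
      ... | false = refl
      ... | true  = cong (λ x → if sortedFrom (toℕ a) as then atLeast j x else 0) (runFlaws-∷ occ a as)

    #flaws≥-step : ∀ {d} k m occ j → n ∸ m ≡ suc d →
                   #flaws≥ (suc k) m occ j ≡ #flaws≥-after k m occ j + #flaws≥ (suc k) (suc m) occ j
    #flaws≥-step {d} k m occ j n∸m≡1+d = begin
      #flaws≥ (suc k) m occ j                             ≡⟨ #flaws≥-suc k m occ j ⟩
      ∑[ i < n ∸ m ] after (m + i)                        ≡⟨ cong (λ e → ∑[ i < e ] after (m + i)) n∸m≡1+d ⟩
      after (m + 0) + ∑[ i < d ] after (m + suc i)        ≡⟨ cong₂ _+_ (cong after (+-identityʳ m))
                                                                      (∑<-cong d (λ i _ → cong after (+-suc m i))) ⟩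
      after m + ∑[ i < d ] after (suc m + i)              ≡⟨ cong (λ e → after m + ∑[ i < e ] after (suc m + i)) n∸1+m≡d ⟨
      after m + ∑[ i < n ∸ suc m ] after (suc m + i)      ≡⟨ cong (after m +_) (#flaws≥-suc k (suc m) occ j) ⟨
      after m + #flaws≥ (suc k) (suc m) occ j             ∎
      where
      after : ℕ → ℕ
      after a = #flaws≥-after k a occ j
      n∸1+m≡d : n ∸ suc m ≡ d
      n∸1+m≡d = trans (sym (pred[m∸n]≡m∸[1+n] n m)) (cong pred n∸m≡1+d)

    #flaws≥-after-free : ∀ k j {t} → Layout m q (suc r) occ →
                         (∀ {occ′} → Layout m (suc q) r occ′ → #flaws≥ k m occ′ j ≡ t) → #flaws≥-after k m occ j ≡ t
    #flaws≥-after-free {m = m} {occ = occ} k j L continue =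
      let occ′ , placed , L′ = place-free L
      in trans (cong (λ o → ∑[ as ∈ allVecs n k ] (if sortedFrom m as then atLeast j (flawsAfter o occ as) else 0)) placed)
               (continue L′)

    #flaws≥-after-full : ∀ k j → Layout m q 0 occ → #flaws≥-after k m occ j ≡ #flaws≥ k m occ (pred j)
    #flaws≥-after-full {m = m} {occ = occ} k j L = begin
      #flaws≥-after k m occ j
        ≡⟨ cong (λ o → ∑[ as ∈ allVecs n k ] (if sortedFrom m as then atLeast j (flawsAfter o occ as) else 0)) (place-full L) ⟩
      ∑[ as ∈ allVecs n k ] (if sortedFrom m as then atLeast j (suc (runFlaws occ as)) else 0)
        ≡⟨ ∑-cong (allVecs n k) (λ as → cong (λ x → if sortedFrom m as then x else 0) (atLeast-suc j (runFlaws occ as))) ⟩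
      #flaws≥ k m occ (pred j) ∎

    #flaws≥≡flawTail : ∀ k r q {m} {occ : Vec Bool n} j → Layout m q r occ → #flaws≥ k m occ j ≡ flawTail k r q j
    #flaws≥≡flawTail zero    r       q       j L = +-identityʳ (atLeast j 0)
    #flaws≥≡flawTail (suc k) zero    zero    {m} {occ} j L =
      trans (#flaws≥-suc k m occ j) (cong (λ e → ∑[ i < e ] #flaws≥-after k (m + i) occ j) (Layout-∸ L))
    #flaws≥≡flawTail (suc k) (suc r) zero    j L = trans (#flaws≥-step k _ _ j (Layout-∸ L)) (cong₂ _+_
      (#flaws≥-after-free k j L (#flaws≥≡flawTail k r 1 j))
      (#flaws≥≡flawTail (suc k) r 0 j (skip-free L)))
    #flaws≥≡flawTail (suc k) (suc r) (suc q) j L = trans (#flaws≥-step k _ _ j (Layout-∸ L)) (cong₂ _+_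
      (#flaws≥-after-free k j L (#flaws≥≡flawTail k r (suc (suc q)) j))
      (#flaws≥≡flawTail (suc k) (suc r) q j (skip-taken L)))
    #flaws≥≡flawTail (suc k) zero    (suc q) j L = trans (#flaws≥-step k _ _ j (Layout-∸ L)) (cong₂ _+_
      (trans (#flaws≥-after-full k j L) (#flaws≥≡flawTail k 0 (suc q) (pred j) L))
      (#flaws≥≡flawTail (suc k) 0 q j (skip-taken L)))

  ∑-ordered-atLeast : ∀ n j → ∑[ P ∈ orderedPrefSets n ] atLeast j (flaws P) ≡ flawTail n n 0 j
  ∑-ordered-atLeast n j = begin
    ∑[ P ∈ orderedPrefSets n ] atLeast j (flaws P)
      ≡⟨ ∑-filter ordered? (allVecs n n) _ ⟩
    ∑[ P ∈ allVecs n n ] (if does (ordered? P) then atLeast j (flaws P) else 0)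
      ≡⟨ ∑-cong (allVecs n n) (λ P → cong (λ b → if b then atLeast j (flaws P) else 0) (does-ordered? P)) ⟩
    Simulation.#flaws≥ n n 0 (replicate n false) j
      ≡⟨ Simulation.#flaws≥≡flawTail n n n 0 j (Layout-empty n) ⟩
    flawTail n n 0 j ∎

module ClosedForm where

  open import Defs using (orderedPrefSets; flaws)
  open Sums
  open Parking using (flawTail; ∑-ordered-atLeast)
  open import Data.Nat using (ℕ; zero; suc; _+_; _∸_; _≤_; _<_; _≤ᵇ_; z≤n; s≤s; z<s; pred; _≤?_)
  open import Data.Nat.Properties
  open import Data.Nat.Combinatorics using (_C_; nCk+nC[k+1]≡[n+1]C[k+1]; k>n⇒nCk≡0)
  open import Data.Bool using (true; false; if_then_else_)
  open import Data.Empty using (⊥-elim)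
  open import Data.Unit using (tt)
  open import Function using (_∘_)
  open import Relation.Nullary using (¬_; yes; no)
  open import Relation.Binary.PropositionalEquality
  open ≡-Reasoning

  -- At least k ∸ r of the k cars find no space, so for j ≤ k ∸ r every sorted sequence counts.
  opaque
    closedTail : ℕ → ℕ → ℕ → ℕ → ℕ
    closedTail k d r j = if j ≤ᵇ k ∸ r then (k + d ∸ 1) C k else (k + d ∸ 1) C (d + j)

    closedTail-≤ : ∀ {k d r j} → j ≤ k ∸ r → closedTail k d r j ≡ (k + d ∸ 1) C k
    closedTail-≤ {k} {d} {r} {j} j≤ with j ≤ᵇ k ∸ r | ≤⇒≤ᵇ j≤
    ... | true | _ = refl

    closedTail-> : ∀ {k d r j} → ¬ j ≤ k ∸ r → closedTail k d r j ≡ (k + d ∸ 1) C (d + j)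
    closedTail-> {k} {d} {r} {j} j≰ with j ≤ᵇ k ∸ r | ≤ᵇ⇒≤ j (k ∸ r)
    ... | false | _  = refl
    ... | true  | j≤ = ⊥-elim (j≰ (j≤ tt))

  C-vanish : ∀ k q {j} → k < j → (k + q) C (q + j) ≡ 0
  C-vanish k q {j} k<j = k>n⇒nCk≡0 (subst (_< q + j) (+-comm q k) (+-monoʳ-< q k<j))

  pascal-all : ∀ k d → (k + suc d ∸ 1) C k + (suc k + d ∸ 1) C suc k ≡ (k + suc d) C suc k
  pascal-all k d rewrite +-suc k d = nCk+nC[k+1]≡[n+1]C[k+1] (k + d) k

  pascal-tail : ∀ k d j → (k + suc d ∸ 1) C (suc d + j) + (suc k + d ∸ 1) C (d + j) ≡ (k + suc d) C (suc d + j)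
  pascal-tail k d j rewrite +-suc k d =
    trans (+-comm ((k + d) C suc (d + j)) _) (nCk+nC[k+1]≡[n+1]C[k+1] (k + d) (d + j))

  ∸-boundary : ∀ k r j → ¬ j ≤ k ∸ r → j ≤ suc k ∸ r → r + j ≡ suc k
  ∸-boundary k       zero    j j≰ j≤ = ≤-antisym j≤ (≰⇒> j≰)
  ∸-boundary zero    (suc r) j j≰ j≤ = ⊥-elim (j≰ (subst (j ≤_) (0∸n≡0 r) j≤))
  ∸-boundary (suc k) (suc r) j j≰ j≤ = cong suc (∸-boundary k r j j≰ j≤)

  closedTail-taken : ∀ k d r j →
    closedTail (suc k) (suc d) (suc r) j ≡ closedTail k (suc d) r j + closedTail (suc k) d (suc r) j
  closedTail-taken k d r j with j ≤? k ∸ r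
  ... | yes j≤ = trans (closedTail-≤ j≤) (sym (trans (cong₂ _+_ (closedTail-≤ j≤) (closedTail-≤ j≤)) (pascal-all k d)))
  ... | no  j≰ = trans (closedTail-> j≰) (sym (trans (cong₂ _+_ (closedTail-> j≰) (closedTail-> j≰)) (pascal-tail k d j)))

  closedTail-free : ∀ k r j →
    closedTail (suc k) (suc r) (suc r) j ≡ closedTail k (suc r) r j + closedTail (suc k) r r j
  closedTail-free k r j with j ≤? k ∸ r | j ≤? suc k ∸ r
  ... | yes j≤ | yes j≤′ =
    trans (closedTail-≤ j≤) (sym (trans (cong₂ _+_ (closedTail-≤ j≤) (closedTail-≤ j≤′)) (pascal-all k r)))
  ... | yes j≤ | no  j≰′ = ⊥-elim (j≰′ (≤-trans j≤ (∸-monoˡ-≤ r (n≤1+n k))))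
  ... | no  j≰ | no  j≰′ =
    trans (closedTail-> j≰) (sym (trans (cong₂ _+_ (closedTail-> j≰) (closedTail-> j≰′)) (pascal-tail k r j)))
  ... | no  j≰ | yes j≤′ = trans (closedTail-> j≰) (sym (begin
    closedTail k (suc r) r j + closedTail (suc k) r r j
      ≡⟨ cong₂ _+_ (closedTail-> j≰) (closedTail-≤ j≤′) ⟩
    (k + suc r ∸ 1) C (suc r + j) + (k + r) C suc k
      ≡⟨ cong (λ i → (k + suc r ∸ 1) C (suc r + j) + (k + r) C i) (∸-boundary k r j j≰ j≤′) ⟨
    (k + suc r ∸ 1) C (suc r + j) + (k + r) C (r + j)
      ≡⟨ pascal-tail k r j ⟩
    (k + suc r) C (suc r + j) ∎))

  closedTail-full : ∀ k q j →
    closedTail (suc k) (suc q) 0 j ≡ closedTail k (suc q) 0 (pred j) + closedTail (suc k) q 0 j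
  closedTail-full k q zero =
    trans (closedTail-≤ z≤n) (sym (trans (cong₂ _+_ (closedTail-≤ z≤n) (closedTail-≤ z≤n)) (pascal-all k q)))
  closedTail-full k q (suc j) with j ≤? k
  ... | yes j≤ =
    trans (closedTail-≤ (s≤s j≤)) (sym (trans (cong₂ _+_ (closedTail-≤ j≤) (closedTail-≤ (s≤s j≤))) (pascal-all k q)))
  ... | no  j≰ = trans (closedTail-> (j≰ ∘ ≤-pred)) (trans (C-vanish k (suc q) k<1+j) (sym (begin
    closedTail k (suc q) 0 j + closedTail (suc k) q 0 (suc j)
      ≡⟨ cong₂ _+_ (closedTail-> j≰) (closedTail-> (j≰ ∘ ≤-pred)) ⟩
    (k + suc q ∸ 1) C (suc q + j) + (k + q) C (q + suc j)
      ≡⟨ cong₂ (λ n i → (n ∸ 1) C i + (k + q) C (q + suc j)) (+-suc k q) (sym (+-suc q j)) ⟩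
    (k + q) C (q + suc j) + (k + q) C (q + suc j)
      ≡⟨ cong (λ x → x + x) (C-vanish k q k<1+j) ⟩
    0 ∎)))
    where
    k<1+j : k < suc j
    k<1+j = m≤n⇒m≤1+n (≰⇒> j≰)

  closedTail-no-cars : ∀ d r j → atLeast j 0 ≡ closedTail 0 d r j
  closedTail-no-cars d r zero    = sym (closedTail-≤ z≤n)
  closedTail-no-cars d r (suc j) = sym (trans (closedTail-> {0} {d} {r} (1+n≰0 ∘ subst (suc j ≤_) (0∸n≡0 r)))
                                              (k>n⇒nCk≡0 (≤-<-trans (m∸n≤m d 1) (m<m+n d z<s))))
    where
    1+n≰0 : ¬ suc j ≤ 0
    1+n≰0 ()

  closedTail-no-spaces : ∀ k j → 0 ≡ closedTail (suc k) 0 0 j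
  closedTail-no-spaces k j with j ≤? suc k
  ... | yes j≤ = sym (trans (closedTail-≤ {suc k} {0} {0} j≤)
                            (k>n⇒nCk≡0 (subst (_< suc k) (sym (+-identityʳ k)) (n<1+n k))))
  ... | no  j≰ = sym (trans (closedTail-> {suc k} {0} {0} j≰)
                            (k>n⇒nCk≡0 (subst (_< j) (sym (+-identityʳ k)) (≤-trans (n≤1+n (suc k)) (≰⇒> j≰)))))

  flawTail≡closedTail : ∀ k r q j → flawTail k r q j ≡ closedTail k (r + q) r j
  flawTail≡closedTail zero    r       q       j = closedTail-no-cars (r + q) r j
  flawTail≡closedTail (suc k) zero    zero    j = closedTail-no-spaces k j
  flawTail≡closedTail (suc k) (suc r) zero    j = begin
    flawTail k r 1 j + flawTail (suc k) r 0 j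
      ≡⟨ cong₂ _+_ (flawTail≡closedTail k r 1 j) (flawTail≡closedTail (suc k) r 0 j) ⟩
    closedTail k (r + 1) r j + closedTail (suc k) (r + 0) r j
      ≡⟨ cong₂ (λ d d′ → closedTail k d r j + closedTail (suc k) d′ r j) (+-comm r 1) (+-identityʳ r) ⟩
    closedTail k (suc r) r j + closedTail (suc k) r r j
      ≡⟨ closedTail-free k r j ⟨
    closedTail (suc k) (suc r) (suc r) j
      ≡⟨ cong (λ d → closedTail (suc k) d (suc r) j) (+-identityʳ (suc r)) ⟨
    closedTail (suc k) (suc r + 0) (suc r) j ∎
  flawTail≡closedTail (suc k) (suc r) (suc q) j = begin
    flawTail k r (suc (suc q)) j + flawTail (suc k) (suc r) q j
      ≡⟨ cong₂ _+_ (flawTail≡closedTail k r (suc (suc q)) j) (flawTail≡closedTail (suc k) (suc r) q j) ⟩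
    closedTail k (r + suc (suc q)) r j + closedTail (suc k) (suc r + q) (suc r) j
      ≡⟨ cong₂ (λ d d′ → closedTail k d r j + closedTail (suc k) d′ (suc r) j) (+-suc r (suc q)) (sym (+-suc r q)) ⟩
    closedTail k (suc (r + suc q)) r j + closedTail (suc k) (r + suc q) (suc r) j
      ≡⟨ closedTail-taken k (r + suc q) r j ⟨
    closedTail (suc k) (suc r + suc q) (suc r) j ∎
  flawTail≡closedTail (suc k) zero    (suc q) j =
    trans (cong₂ _+_ (flawTail≡closedTail k 0 (suc q) (pred j)) (flawTail≡closedTail (suc k) 0 q j))
          (sym (closedTail-full k q j))

  ∑-atLeast-flaws : ∀ p j → ∑[ P ∈ orderedPrefSets (suc p) ] atLeast j (flaws P) ≡ (suc p + p) C (j + suc p)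
  ∑-atLeast-flaws p j = begin
    ∑[ P ∈ orderedPrefSets (suc p) ] atLeast j (flaws P)  ≡⟨ ∑-ordered-atLeast (suc p) j ⟩
    flawTail (suc p) (suc p) 0 j                          ≡⟨ flawTail≡closedTail (suc p) (suc p) 0 j ⟩
    closedTail (suc p) (suc p + 0) (suc p) j              ≡⟨ cong (λ d → closedTail (suc p) d (suc p) j) (+-identityʳ (suc p)) ⟩
    closedTail (suc p) (suc p) (suc p) j                  ≡⟨ evaluate j ⟩
    (p + suc p) C (j + suc p)                             ≡⟨ cong (_C (j + suc p)) (+-suc p p) ⟩
    (suc p + p) C (j + suc p)                             ∎
    where
    evaluate : ∀ j → closedTail (suc p) (suc p) (suc p) j ≡ (p + suc p) C (j + suc p)
    evaluate zero    = closedTail-≤ {suc p} {suc p} {suc p} z≤n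
    evaluate (suc j) = trans (closedTail-> {suc p} {suc p} {suc p} (λ j≤ → 1+j≰0 (subst (suc j ≤_) (n∸n≡0 p) j≤)))
                             (cong ((p + suc p) C_) (+-comm (suc p) (suc j)))
      where
      1+j≰0 : ¬ suc j ≤ 0
      1+j≰0 ()

module BinomialSums where

  open Sums
  open import Data.Nat using (zero; suc; _+_; _*_; _^_; _≤_; _<_; z≤n; s≤s; z<s)
  open import Data.Nat.Properties
  open import Data.Nat.Combinatorics using (_C_; nCk+nC[k+1]≡[n+1]C[k+1]; nC1≡n; k>n⇒nCk≡0)
  open import Data.Nat.Tactic.RingSolver using (solve-∀)
  open import Relation.Binary.PropositionalEquality
  open ≡-Reasoning

  ∑-binomial : ∀ n K → n < K → ∑[ i < K ] (n C i) ≡ 2 ^ n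
  ∑-binomial zero    (suc K) _         = cong suc (∑<-zero K)
  ∑-binomial (suc n) (suc K) (s≤s n<K) = begin
    1 + ∑[ i < K ] (suc n C suc i)
      ≡⟨ cong (1 +_) (∑<-cong K (λ i _ → nCk+nC[k+1]≡[n+1]C[k+1] n i)) ⟨
    1 + ∑[ i < K ] (n C i + n C suc i)
      ≡⟨ cong (1 +_) (∑<-+ K (n C_) (λ i → n C suc i)) ⟩
    1 + (∑[ i < K ] (n C i) + ∑[ i < K ] (n C suc i))
      ≡⟨ rotate 1 (∑[ i < K ] (n C i)) _ ⟩
    ∑[ i < K ] (n C i) + ∑[ i < suc K ] (n C i)
      ≡⟨ cong₂ _+_ (∑-binomial n K n<K) (∑-binomial n (suc K) (m≤n⇒m≤1+n n<K)) ⟩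
    2 ^ n + 2 ^ n
      ≡⟨ cong (2 ^ n +_) (+-identityʳ (2 ^ n)) ⟨
    2 ^ suc n ∎
    where
    rotate : ∀ a b c → a + (b + c) ≡ b + (a + c)
    rotate = solve-∀

  -- Absorption k C(n,k) = n C(n-1,k-1), summed over two neighbouring k.
  C-absorb : ∀ n k → suc k * (n C suc k) + k * (n C k) ≡ n * (n C k)
  C-absorb zero    zero    = refl
  C-absorb zero    (suc k) rewrite k>n⇒nCk≡0 {0} {suc k} z<s | k>n⇒nCk≡0 {0} {suc (suc k)} z<s =
    cong₂ _+_ (*-zeroʳ (suc (suc k))) (*-zeroʳ (suc k))
  C-absorb (suc n) zero    = trans (+-identityʳ _) (trans (*-identityˡ _) (trans (nC1≡n (suc n)) (sym (*-identityʳ (suc n)))))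
  C-absorb (suc n) (suc k) = begin
    suc (suc k) * (suc n C suc (suc k)) + suc k * (suc n C suc k)
      ≡⟨ cong₂ (λ x y → suc (suc k) * x + suc k * y) (nCk+nC[k+1]≡[n+1]C[k+1] n (suc k)) (nCk+nC[k+1]≡[n+1]C[k+1] n k) ⟨
    suc (suc k) * (b + c) + suc k * (a + b)
      ≡⟨ regroup k a b c ⟩
    (suc (suc k) * c + suc k * b) + (suc k * b + k * a) + (a + b)
      ≡⟨ cong₂ (λ x y → x + y + (a + b)) (C-absorb n (suc k)) (C-absorb n k) ⟩
    n * b + n * a + (a + b)
      ≡⟨ collect n a b ⟩
    suc n * (a + b)
      ≡⟨ cong (suc n *_) (nCk+nC[k+1]≡[n+1]C[k+1] n k) ⟩
    suc n * (suc n C suc k) ∎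
    where
    a = n C k
    b = n C suc k
    c = n C suc (suc k)
    regroup : ∀ k a b c → suc (suc k) * (b + c) + suc k * (a + b) ≡ (suc (suc k) * c + suc k * b) + (suc k * b + k * a) + (a + b)
    regroup = solve-∀
    collect : ∀ n a b → n * b + n * a + (a + b) ≡ suc n * (a + b)
    collect = solve-∀

  C-pos : ∀ {n k} → k ≤ n → 0 < n C k
  C-pos {n}     {zero}  _         = s≤s z≤n
  C-pos {suc n} {suc k} (s≤s k≤n) = subst (0 <_) (nCk+nC[k+1]≡[n+1]C[k+1] n k) (≤-trans (C-pos k≤n) (m≤m+n _ _))

module Fractions where

  open import Defs using (_/ℕ_; fromℕ; sumℚ; mean; variance)
  open Sums using (∑)
  open import Data.Nat as ℕ using (ℕ; suc)
  open import Data.Integer as ℤ using ()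
  import Data.Integer.Properties as ℤ
  open import Data.Integer.Tactic.RingSolver using () renaming (solve-∀ to solve-∀ℤ)
  open import Data.Rational using (ℚ; _+_; _*_; _-_; 0ℚ; 1ℚ; toℚᵘ)
  open import Data.Rational.Properties
    using (toℚᵘ-injective; toℚᵘ-fromℚᵘ; toℚᵘ-homo-+; toℚᵘ-homo-*; +-*-commutativeRing; _≟_;
           *-comm; *-assoc; *-identityˡ; *-identityʳ; *-distribʳ-+; *-distribˡ-+)
  import Data.Rational.Unnormalised as ℚᵘ
  import Data.Rational.Unnormalised.Properties as ℚᵘ
  open import Data.List using (List; []; _∷_; map; length)
  open import Data.List.Properties using (length-map)
  open import Data.Product using (_×_; _,_)
  open import Level using (0ℓ)
  open import Relation.Nullary.Decidable using (dec⇒maybe)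
  open import Relation.Binary.PropositionalEquality
  import Tactic.RingSolver.Core.AlmostCommutativeRing as ACR
  open import Tactic.RingSolver using (solve-∀; solve)

  ℚ-ring : ACR.AlmostCommutativeRing 0ℓ 0ℓ
  ℚ-ring = ACR.fromCommutativeRing +-*-commutativeRing (λ x → dec⇒maybe (0ℚ ≟ x))

  private
    toℚᵘ-/ℕ : ∀ a b → toℚᵘ (a /ℕ suc b) ℚᵘ.≃ ℚᵘ.mkℚᵘ (ℤ.+ a) b
    toℚᵘ-/ℕ a b = toℚᵘ-fromℚᵘ (ℚᵘ.mkℚᵘ (ℤ.+ a) b)

  fromℕ-+ : ∀ a b → fromℕ (a ℕ.+ b) ≡ fromℕ a + fromℕ b
  fromℕ-+ a b = toℚᵘ-injective (begin-equality
    toℚᵘ (fromℕ (a ℕ.+ b))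
      ≃⟨ toℚᵘ-/ℕ (a ℕ.+ b) 0 ⟩
    ℚᵘ.mkℚᵘ (ℤ.+ (a ℕ.+ b)) 0
      ≃⟨ ℚᵘ.*≡* (trans (cong (ℤ._* ℤ.+ 1) (ℤ.pos-+ a b)) (distrib (ℤ.+ a) (ℤ.+ b))) ⟩
    ℚᵘ.mkℚᵘ (ℤ.+ a) 0 ℚᵘ.+ ℚᵘ.mkℚᵘ (ℤ.+ b) 0
      ≃⟨ ℚᵘ.+-cong (toℚᵘ-/ℕ a 0) (toℚᵘ-/ℕ b 0) ⟨
    toℚᵘ (fromℕ a) ℚᵘ.+ toℚᵘ (fromℕ b)
      ≃⟨ toℚᵘ-homo-+ (fromℕ a) (fromℕ b) ⟨
    toℚᵘ (fromℕ a + fromℕ b) ∎)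
    where
    open ℚᵘ.≤-Reasoning
    distrib : ∀ x y → (x ℤ.+ y) ℤ.* ℤ.+ 1 ≡ (x ℤ.* ℤ.+ 1 ℤ.+ y ℤ.* ℤ.+ 1) ℤ.* ℤ.+ 1
    distrib = solve-∀ℤ

  fromℕ-* : ∀ a b → fromℕ (a ℕ.* b) ≡ fromℕ a * fromℕ b
  fromℕ-* a b = toℚᵘ-injective (begin-equality
    toℚᵘ (fromℕ (a ℕ.* b))
      ≃⟨ toℚᵘ-/ℕ (a ℕ.* b) 0 ⟩
    ℚᵘ.mkℚᵘ (ℤ.+ (a ℕ.* b)) 0
      ≃⟨ ℚᵘ.*≡* (cong (ℤ._* ℤ.+ 1) (ℤ.pos-* a b)) ⟩
    ℚᵘ.mkℚᵘ (ℤ.+ a) 0 ℚᵘ.* ℚᵘ.mkℚᵘ (ℤ.+ b) 0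
      ≃⟨ ℚᵘ.*-cong (toℚᵘ-/ℕ a 0) (toℚᵘ-/ℕ b 0) ⟨
    toℚᵘ (fromℕ a) ℚᵘ.* toℚᵘ (fromℕ b)
      ≃⟨ toℚᵘ-homo-* (fromℕ a) (fromℕ b) ⟨
    toℚᵘ (fromℕ a * fromℕ b) ∎)
    where open ℚᵘ.≤-Reasoning

  /ℕ-*-fromℕ : ∀ a b → (a /ℕ suc b) * fromℕ (suc b) ≡ fromℕ a
  /ℕ-*-fromℕ a b = toℚᵘ-injective (begin-equality
    toℚᵘ ((a /ℕ suc b) * fromℕ (suc b))
      ≃⟨ toℚᵘ-homo-* (a /ℕ suc b) (fromℕ (suc b)) ⟩
    toℚᵘ (a /ℕ suc b) ℚᵘ.* toℚᵘ (fromℕ (suc b))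
      ≃⟨ ℚᵘ.*-cong (toℚᵘ-/ℕ a b) (toℚᵘ-/ℕ (suc b) 0) ⟩
    ℚᵘ.mkℚᵘ (ℤ.+ a) b ℚᵘ.* ℚᵘ.mkℚᵘ (ℤ.+ suc b) 0
      ≃⟨ ℚᵘ.*≡* (reassoc (ℤ.+ a) (ℤ.+ suc b)) ⟩
    ℚᵘ.mkℚᵘ (ℤ.+ a) 0
      ≃⟨ toℚᵘ-/ℕ a 0 ⟨
    toℚᵘ (fromℕ a) ∎)
    where
    open ℚᵘ.≤-Reasoning
    reassoc : ∀ x y → (x ℤ.* y) ℤ.* ℤ.+ 1 ≡ x ℤ.* (y ℤ.* ℤ.+ 1)
    reassoc = solve-∀ℤ

  *-cancelʳ-invertible : ∀ {x y n i} → n * i ≡ 1ℚ → x * n ≡ y * n → x ≡ y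
  *-cancelʳ-invertible {x} {y} {n} {i} n*i≡1 x*n≡y*n = begin
    x              ≡⟨ solve (x ∷ []) ℚ-ring ⟩
    x * 1ℚ         ≡⟨ cong (x *_) n*i≡1 ⟨
    x * (n * i)    ≡⟨ solve (x ∷ n ∷ i ∷ []) ℚ-ring ⟩
    (x * n) * i    ≡⟨ cong (_* i) x*n≡y*n ⟩
    (y * n) * i    ≡⟨ solve (y ∷ n ∷ i ∷ []) ℚ-ring ⟩
    y * (n * i)    ≡⟨ cong (y *_) n*i≡1 ⟩
    y * 1ℚ         ≡⟨ solve (y ∷ []) ℚ-ring ⟩
    y              ∎
    where open ≡-Reasoning

  fromℕ*1/ℕ : ∀ b → fromℕ (suc b) * (1 /ℕ suc b) ≡ 1ℚ
  fromℕ*1/ℕ b = trans (*-comm (fromℕ (suc b)) (1 /ℕ suc b)) (/ℕ-*-fromℕ 1 b)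

  /ℕ-unique : ∀ {z} a b → z * fromℕ (suc b) ≡ fromℕ a → z ≡ a /ℕ suc b
  /ℕ-unique a b z*n≡a = *-cancelʳ-invertible (fromℕ*1/ℕ b) (trans z*n≡a (sym (/ℕ-*-fromℕ a b)))

  /ℕ-+ : ∀ a b c → (a ℕ.+ b) /ℕ suc c ≡ a /ℕ suc c + b /ℕ suc c
  /ℕ-+ a b c = sym (/ℕ-unique (a ℕ.+ b) c (begin
    (a /ℕ suc c + b /ℕ suc c) * fromℕ (suc c)                    ≡⟨ *-distribʳ-+ (fromℕ (suc c)) (a /ℕ suc c) _ ⟩
    (a /ℕ suc c) * fromℕ (suc c) + (b /ℕ suc c) * fromℕ (suc c)  ≡⟨ cong₂ _+_ (/ℕ-*-fromℕ a c) (/ℕ-*-fromℕ b c) ⟩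
    fromℕ a + fromℕ b                                            ≡⟨ fromℕ-+ a b ⟨
    fromℕ (a ℕ.+ b)                                              ∎))
    where open ≡-Reasoning

  /ℕ-*ˡ : ∀ k a c → (k ℕ.* a) /ℕ suc c ≡ fromℕ k * (a /ℕ suc c)
  /ℕ-*ˡ k a c = sym (/ℕ-unique (k ℕ.* a) c (begin
    fromℕ k * (a /ℕ suc c) * fromℕ (suc c)   ≡⟨ *-assoc (fromℕ k) _ _ ⟩
    fromℕ k * ((a /ℕ suc c) * fromℕ (suc c)) ≡⟨ cong (fromℕ k *_) (/ℕ-*-fromℕ a c) ⟩
    fromℕ k * fromℕ a                        ≡⟨ fromℕ-* k a ⟨
    fromℕ (k ℕ.* a)                          ∎))
    where open ≡-Reasoning

  /ℕ-self : ∀ c → suc c /ℕ suc c ≡ 1ℚ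
  /ℕ-self c = sym (/ℕ-unique (suc c) c (*-identityˡ (fromℕ (suc c))))

  /ℕ-double : ∀ a b → (a ℕ.+ a) /ℕ (suc b ℕ.+ suc b) ≡ a /ℕ suc b
  /ℕ-double a b = sym (/ℕ-unique (a ℕ.+ a) (b ℕ.+ suc b) (begin
    (a /ℕ suc b) * fromℕ (suc b ℕ.+ suc b)                      ≡⟨ cong ((a /ℕ suc b) *_) (fromℕ-+ (suc b) (suc b)) ⟩
    (a /ℕ suc b) * (fromℕ (suc b) + fromℕ (suc b))              ≡⟨ *-distribˡ-+ (a /ℕ suc b) _ _ ⟩
    (a /ℕ suc b) * fromℕ (suc b) + (a /ℕ suc b) * fromℕ (suc b) ≡⟨ cong₂ _+_ (/ℕ-*-fromℕ a b) (/ℕ-*-fromℕ a b) ⟩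
    fromℕ a + fromℕ a                                           ≡⟨ fromℕ-+ a a ⟨
    fromℕ (a ℕ.+ a)                                             ∎))
    where open ≡-Reasoning

  private variable
    A : Set

  sumℚ-fromℕ : ∀ (xs : List A) (f : A → ℕ) → sumℚ (map (λ x → fromℕ (f x)) xs) ≡ fromℕ (∑ xs f)
  sumℚ-fromℕ []       f = refl
  sumℚ-fromℕ (x ∷ xs) f = trans (cong (fromℕ (f x) +_) (sumℚ-fromℕ xs f)) (sym (fromℕ-+ (f x) (∑ xs f)))

  fromℕ*1/ℕ≡/ℕ : ∀ a b → fromℕ a * (1 /ℕ suc b) ≡ a /ℕ suc b
  fromℕ*1/ℕ≡/ℕ a b = /ℕ-unique a b (begin
    fromℕ a * (1 /ℕ suc b) * fromℕ (suc b)   ≡⟨ *-assoc (fromℕ a) _ _ ⟩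
    fromℕ a * ((1 /ℕ suc b) * fromℕ (suc b)) ≡⟨ cong (fromℕ a *_) (/ℕ-*-fromℕ 1 b) ⟩
    fromℕ a * 1ℚ                             ≡⟨ *-identityʳ (fromℕ a) ⟩
    fromℕ a                                  ∎)
    where open ≡-Reasoning

  mean-fromℕ : ∀ (xs : List A) (f : A → ℕ) {n} → length xs ≡ suc n →
               mean (map (λ x → fromℕ (f x)) xs) ≡ ∑ xs f /ℕ suc n
  mean-fromℕ xs f {n} len = trans (cong₂ (λ s l → s * (1 /ℕ l)) (sumℚ-fromℕ xs f) (trans (length-map _ xs) len))
                                  (fromℕ*1/ℕ≡/ℕ (∑ xs f) n)

  ∑-squared-deviation : ∀ (xs : List A) (f : A → ℕ) c →
    sumℚ (map (λ x → (x - c) * (x - c)) (map (λ x → fromℕ (f x)) xs))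
      ≡ fromℕ (∑[ x ∈ xs ] (f x ℕ.* f x)) - (c + c) * fromℕ (∑ xs f) + fromℕ (length xs) * (c * c)
  ∑-squared-deviation []       f c = empty c
    where
    empty : ∀ c → 0ℚ ≡ 0ℚ - (c + c) * 0ℚ + 0ℚ * (c * c)
    empty = solve-∀ ℚ-ring
  ∑-squared-deviation (x ∷ xs) f c = begin
    (a - c) * (a - c) + sumℚ (map (λ x → (x - c) * (x - c)) (map (λ x → fromℕ (f x)) xs))
      ≡⟨ cong ((a - c) * (a - c) +_) (∑-squared-deviation xs f c) ⟩
    (a - c) * (a - c) + (fromℕ S₂ - (c + c) * fromℕ S₁ + fromℕ l * (c * c))
      ≡⟨ expand a c (fromℕ S₂) (fromℕ S₁) (fromℕ l) ⟩
    (a * a + fromℕ S₂) - (c + c) * (a + fromℕ S₁) + (1ℚ + fromℕ l) * (c * c)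
      ≡⟨ cong₂ (λ u v → u - (c + c) * v + (1ℚ + fromℕ l) * (c * c))
               (trans (fromℕ-+ (f x ℕ.* f x) S₂) (cong (_+ fromℕ S₂) (fromℕ-* (f x) (f x)))) (fromℕ-+ (f x) S₁) ⟨
    fromℕ (f x ℕ.* f x ℕ.+ S₂) - (c + c) * fromℕ (f x ℕ.+ S₁) + (1ℚ + fromℕ l) * (c * c)
      ≡⟨ cong (λ u → fromℕ (f x ℕ.* f x ℕ.+ S₂) - (c + c) * fromℕ (f x ℕ.+ S₁) + u * (c * c)) (fromℕ-+ 1 l) ⟨
    fromℕ (f x ℕ.* f x ℕ.+ S₂) - (c + c) * fromℕ (f x ℕ.+ S₁) + fromℕ (suc l) * (c * c) ∎
    where
    open ≡-Reasoning
    a  = fromℕ (f x)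
    S₁ = ∑ xs f
    S₂ = ∑[ x ∈ xs ] (f x ℕ.* f x)
    l  = length xs
    expand : ∀ a c s₂ s₁ l → (a - c) * (a - c) + (s₂ - (c + c) * s₁ + l * (c * c))
                           ≡ (a * a + s₂) - (c + c) * (a + s₁) + (1ℚ + l) * (c * c)
    expand = solve-∀ ℚ-ring

  variance-fromℕ : ∀ (xs : List A) (f : A → ℕ) {n} → length xs ≡ suc n →
    variance (map (λ x → fromℕ (f x)) xs)
      ≡ (∑[ x ∈ xs ] (f x ℕ.* f x)) /ℕ suc n - (∑ xs f /ℕ suc n) * (∑ xs f /ℕ suc n)
  variance-fromℕ xs f {n} len = begin
    sumℚ (map (λ y → (y - μ′) * (y - μ′)) ys) * (1 /ℕ length (map (λ y → (y - μ′) * (y - μ′)) ys))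
      ≡⟨ cong (λ l → sumℚ (map (λ y → (y - μ′) * (y - μ′)) ys) * (1 /ℕ l))
              (trans (length-map (λ y → (y - μ′) * (y - μ′)) ys) (trans (length-map (λ x → fromℕ (f x)) xs) len)) ⟩
    sumℚ (map (λ y → (y - μ′) * (y - μ′)) ys) * I
      ≡⟨ cong (_* I) (∑-squared-deviation xs f μ′) ⟩
    (fromℕ S₂ - (μ′ + μ′) * fromℕ S₁ + fromℕ (length xs) * (μ′ * μ′)) * I
      ≡⟨ cong₂ (λ c l → (fromℕ S₂ - (c + c) * fromℕ S₁ + fromℕ l * (c * c)) * I) μ′≡μ len ⟩
    (fromℕ S₂ - (μ + μ) * fromℕ S₁ + fromℕ (suc n) * (μ * μ)) * I
      ≡⟨ distribute (fromℕ S₂) (fromℕ S₁) (fromℕ (suc n)) μ I ⟩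
    fromℕ S₂ * I - (μ + μ) * (fromℕ S₁ * I) + (fromℕ (suc n) * I) * (μ * μ)
      ≡⟨ cong₃ (λ u v w → u - (μ + μ) * v + w * (μ * μ))
               (fromℕ*1/ℕ≡/ℕ S₂ n) (fromℕ*1/ℕ≡/ℕ S₁ n) (fromℕ*1/ℕ n) ⟩
    S₂ /ℕ suc n - (μ + μ) * μ + 1ℚ * (μ * μ)
      ≡⟨ collect (S₂ /ℕ suc n) μ ⟩
    S₂ /ℕ suc n - μ * μ ∎
    where
    open ≡-Reasoning
    ys = map (λ x → fromℕ (f x)) xs
    μ′ = mean ys
    μ  = ∑ xs f /ℕ suc n
    S₁ = ∑ xs f
    S₂ = ∑[ x ∈ xs ] (f x ℕ.* f x)
    I  = 1 /ℕ suc n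
    μ′≡μ : μ′ ≡ μ
    μ′≡μ = mean-fromℕ xs f len
    cong₃ : ∀ {B C D E : Set} (h : B → C → D → E) {x x′ y y′ z z′} →
            x ≡ x′ → y ≡ y′ → z ≡ z′ → h x y z ≡ h x′ y′ z′
    cong₃ h refl refl refl = refl
    distribute : ∀ s₂ s₁ l μ i →
                 (s₂ - (μ + μ) * s₁ + l * (μ * μ)) * i ≡ s₂ * i - (μ + μ) * (s₁ * i) + (l * i) * (μ * μ)
    distribute = solve-∀ ℚ-ring
    collect : ∀ e μ → e - (μ + μ) * μ + 1ℚ * (μ * μ) ≡ e - μ * μ
    collect = solve-∀ ℚ-ring

  moments-from-power-sums : ∀ (xs : List A) (f : A → ℕ) n N S₁ S₂ →
    length xs ≡ suc N → ∑ xs f ≡ S₁ → ∑[ x ∈ xs ] (f x ℕ.* f x) ≡ S₂ →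
    suc N ℕ.+ S₂ ℕ.+ 2 ℕ.* S₁ ≡ n ℕ.* suc N →
    mean (map (λ x → fromℕ (f x)) xs) ≡ (suc N ℕ.+ S₁) /ℕ suc N - 1ℚ
    × variance (map (λ x → fromℕ (f x)) xs) ≡ fromℕ n - ((suc N ℕ.+ S₁) /ℕ suc N) * ((suc N ℕ.+ S₁) /ℕ suc N)
  moments-from-power-sums xs f n N S₁ S₂ len refl refl relation = mean-eq , variance-eq
    where
    open ≡-Reasoning
    μ  = S₁ /ℕ suc N
    E₂ = S₂ /ℕ suc N
    Q  = (suc N ℕ.+ S₁) /ℕ suc N

    Q≡1+μ : Q ≡ 1ℚ + μ
    Q≡1+μ = trans (/ℕ-+ (suc N) S₁ N) (cong (_+ μ) (/ℕ-self N))

    mean-eq : mean (map (λ x → fromℕ (f x)) xs) ≡ Q - 1ℚ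
    mean-eq = begin
      mean (map (λ x → fromℕ (f x)) xs)  ≡⟨ mean-fromℕ xs f len ⟩
      μ                                  ≡⟨ shift μ ⟩
      (1ℚ + μ) - 1ℚ                      ≡⟨ cong (_- 1ℚ) Q≡1+μ ⟨
      Q - 1ℚ                             ∎
      where
      shift : ∀ μ → μ ≡ (1ℚ + μ) - 1ℚ
      shift = solve-∀ ℚ-ring

    relationℚ : 1ℚ + E₂ + (1ℚ + 1ℚ) * μ ≡ fromℕ n
    relationℚ = begin
      1ℚ + E₂ + (1ℚ + 1ℚ) * μ                         ≡⟨ cong₂ (λ u v → u + E₂ + v * μ) (/ℕ-self N)
                                                                    (trans (fromℕ-+ 1 1) (cong₂ _+_ (/ℕ-self 0) (/ℕ-self 0))) ⟨
      suc N /ℕ suc N + E₂ + fromℕ 2 * μ                ≡⟨ cong₂ _+_ (/ℕ-+ (suc N) S₂ N) (/ℕ-*ˡ 2 S₁ N) ⟨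
      (suc N ℕ.+ S₂) /ℕ suc N + (2 ℕ.* S₁) /ℕ suc N    ≡⟨ /ℕ-+ (suc N ℕ.+ S₂) (2 ℕ.* S₁) N ⟨
      (suc N ℕ.+ S₂ ℕ.+ 2 ℕ.* S₁) /ℕ suc N            ≡⟨ cong (_/ℕ suc N) relation ⟩
      (n ℕ.* suc N) /ℕ suc N                          ≡⟨ /ℕ-*ˡ n (suc N) N ⟩
      fromℕ n * (suc N /ℕ suc N)                      ≡⟨ cong (fromℕ n *_) (/ℕ-self N) ⟩
      fromℕ n * 1ℚ                                    ≡⟨ *-identityʳ (fromℕ n) ⟩
      fromℕ n                                         ∎

    variance-eq : variance (map (λ x → fromℕ (f x)) xs) ≡ fromℕ n - Q * Q
    variance-eq = begin
      variance (map (λ x → fromℕ (f x)) xs)            ≡⟨ variance-fromℕ xs f len ⟩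
      E₂ - μ * μ                                       ≡⟨ complete-square E₂ μ ⟩
      (1ℚ + E₂ + (1ℚ + 1ℚ) * μ) - (1ℚ + μ) * (1ℚ + μ)  ≡⟨ cong₂ (λ u v → u - v * v) relationℚ (sym Q≡1+μ) ⟩
      fromℕ n - Q * Q                                  ∎
      where
      complete-square : ∀ e μ → e - μ * μ ≡ (1ℚ + e + (1ℚ + 1ℚ) * μ) - (1ℚ + μ) * (1ℚ + μ)
      complete-square = solve-∀ ℚ-ring

open import Defs
open import Data.Nat using (ℕ; zero; suc; _≤_; _*_; _∸_; _^_)
open import Data.Nat.Combinatorics using (_C_)
open import Data.Rational using (ℚ; _-_; 1ℚ) renaming (_*_ to _*ℚ_)
open import Data.Product using (_×_)
open import Relation.Binary.PropositionalEquality using (_≡_; subst; sym)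

module FlawMoments (p : ℕ) where

  open Sums
  open Parking using (runFlaws-≤)
  open ClosedForm using (∑-atLeast-flaws)
  open BinomialSums using (∑-binomial; C-absorb; C-pos)
  open Fractions using (/ℕ-double)
  open import Data.Nat using (_+_; _<_; pred; >-nonZero)
  open import Data.Nat.Properties
  open import Data.Nat.Combinatorics using (nCk≡nC[n∸k]; nCk+nC[k+1]≡[n+1]C[k+1]; k>n⇒nCk≡0)
  open import Data.Nat.Tactic.RingSolver using (solve-∀)
  open import Data.List using (length)
  open import Relation.Binary.PropositionalEquality using (cong; cong₂; trans; module ≡-Reasoning)
  open ≡-Reasoning

  m : ℕ
  m = suc p + p

  tailCount : ℕ → ℕ
  tailCount j = m C (j + suc p)

  S₁ S₂ : ℕ
  S₁ = ∑[ i < suc p ] tailCount (suc i)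
  S₂ = ∑[ i < suc p ] ((1 + 2 * i) * tailCount (suc i))

  ∑-weighted-flaws : ∀ (h : ℕ → ℕ) →
    ∑[ P ∈ orderedPrefSets (suc p) ] ∑< (flaws P) h ≡ ∑[ i < suc p ] (h i * tailCount (suc i))
  ∑-weighted-flaws h = trans (∑-layers (orderedPrefSets (suc p)) flaws (suc p) h (λ P → runFlaws-≤ _ P))
                             (∑<-cong (suc p) (λ i _ → cong (h i *_) (∑-atLeast-flaws p (suc i))))

  ∑-flaws : ∑[ P ∈ orderedPrefSets (suc p) ] flaws P ≡ S₁
  ∑-flaws = begin
    ∑[ P ∈ orderedPrefSets (suc p) ] flaws P             ≡⟨ ∑-cong (orderedPrefSets (suc p)) (λ P → ∑<-one (flaws P)) ⟨
    ∑[ P ∈ orderedPrefSets (suc p) ] ∑[ i < flaws P ] 1  ≡⟨ ∑-weighted-flaws (λ _ → 1) ⟩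
    ∑[ i < suc p ] (1 * tailCount (suc i))               ≡⟨ ∑<-cong (suc p) (λ i _ → *-identityˡ (tailCount (suc i))) ⟩
    S₁                                                   ∎

  ∑-flaws² : ∑[ P ∈ orderedPrefSets (suc p) ] (flaws P * flaws P) ≡ S₂
  ∑-flaws² = trans (∑-cong (orderedPrefSets (suc p)) (λ P → sym (∑<-odd (flaws P))))
                   (∑-weighted-flaws (λ i → 1 + 2 * i))

  m<2+2p : m < suc p + suc p
  m<2+2p = +-monoʳ-< (suc p) (n<1+n p)

  tailCount-mirror : ∀ i → i ≤ p → tailCount (p ∸ i) ≡ m C i
  tailCount-mirror i i≤p = sym (begin
    m C i                  ≡⟨ nCk≡nC[n∸k] (≤-trans i≤p (m≤n+m p (suc p))) ⟩
    m C (m ∸ i)            ≡⟨ cong (m C_) (+-∸-assoc (suc p) i≤p) ⟩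
    m C (suc p + (p ∸ i))  ≡⟨ cong (m C_) (+-comm (suc p) (p ∸ i)) ⟩
    tailCount (p ∸ i)      ∎)

  -- The upper half of row m of Pascal's triangle mirrors the lower half.
  ∑-upper-half : ∑< (suc p) tailCount + ∑< (suc p) tailCount ≡ 2 ^ m
  ∑-upper-half = begin
    ∑< (suc p) tailCount + ∑< (suc p) tailCount
      ≡⟨ cong (_+ ∑< (suc p) tailCount) (∑<-reverse (suc p) tailCount) ⟨
    ∑[ i < suc p ] tailCount (p ∸ i) + ∑< (suc p) tailCount
      ≡⟨ cong₂ _+_ (∑<-cong (suc p) (λ i i<1+p → tailCount-mirror i (≤-pred i<1+p)))
                   (∑<-cong (suc p) (λ i _ → cong (m C_) (+-comm i (suc p)))) ⟩
    ∑[ i < suc p ] (m C i) + ∑[ i < suc p ] (m C (suc p + i))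
      ≡⟨ ∑<-split (suc p) (suc p) (m C_) ⟨
    ∑[ i < suc p + suc p ] (m C i)
      ≡⟨ ∑-binomial m (suc p + suc p) m<2+2p ⟩
    2 ^ m ∎

  tailCount0+S₁ : tailCount 0 + S₁ ≡ ∑< (suc p) tailCount
  tailCount0+S₁ = begin
    ∑< (suc (suc p)) tailCount                ≡⟨ ∑<-snoc (suc p) tailCount ⟩
    ∑< (suc p) tailCount + tailCount (suc p)  ≡⟨ cong (∑< (suc p) tailCount +_) (k>n⇒nCk≡0 m<2+2p) ⟩
    ∑< (suc p) tailCount + 0                  ≡⟨ +-identityʳ _ ⟩
    ∑< (suc p) tailCount                      ∎

  -- Absorption makes t j = a j - a (j + 1), so the weighted sum telescopes.
  telescoping : tailCount 0 + S₂ + 2 * S₁ ≡ suc p * tailCount 0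
  telescoping = begin
    tailCount 0 + S₂ + 2 * S₁                      ≡⟨ +-assoc (tailCount 0) S₂ _ ⟩
    tailCount 0 + (S₂ + 2 * S₁)                    ≡⟨ cong₂ _+_ (*-identityˡ (tailCount 0)) shifted ⟨
    ∑[ j < suc (suc p) ] t j                       ≡⟨ +-identityʳ _ ⟨
    ∑[ j < suc (suc p) ] t j + 0                   ≡⟨ cong (∑[ j < suc (suc p) ] t j +_) a-vanishes ⟨
    ∑[ j < suc (suc p) ] t j + a (suc (suc p))     ≡⟨ ∑<-telescope (suc (suc p)) t a (λ j _ → t+a≡a j) ⟩
    suc p * tailCount 0                            ∎
    where
    t a : ℕ → ℕ
    t j = (1 + 2 * j) * tailCount j
    a j = (j + suc p) * tailCount j
    t+a≡a : ∀ j → t j + a (suc j) ≡ a j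
    t+a≡a j = +-cancelʳ-≡ (a j) _ _ (begin
      t j + a (suc j) + a j                ≡⟨ +-assoc (t j) _ _ ⟩
      t j + (a (suc j) + a j)              ≡⟨ cong (t j +_) (C-absorb m (j + suc p)) ⟩
      t j + m * tailCount j                ≡⟨ double j p (tailCount j) ⟩
      a j + a j                            ∎)
      where
      double : ∀ j p x → (1 + 2 * j) * x + (suc p + p) * x ≡ (j + suc p) * x + (j + suc p) * x
      double = solve-∀
    a-vanishes : a (suc (suc p)) ≡ 0
    a-vanishes = trans (cong ((suc (suc p) + suc p) *_) (k>n⇒nCk≡0 (≤-trans m<2+2p (n≤1+n _))))
                       (*-zeroʳ (suc (suc p) + suc p))
    shifted : ∑[ i < suc p ] t (suc i) ≡ S₂ + 2 * S₁
    shifted = begin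
      ∑[ i < suc p ] t (suc i)
        ≡⟨ ∑<-cong (suc p) (λ i _ → odd-suc i (tailCount (suc i))) ⟩
      ∑[ i < suc p ] ((1 + 2 * i) * tailCount (suc i) + 2 * tailCount (suc i))
        ≡⟨ ∑<-+ (suc p) (λ i → (1 + 2 * i) * tailCount (suc i)) (λ i → 2 * tailCount (suc i)) ⟩
      S₂ + ∑[ i < suc p ] (2 * tailCount (suc i))
        ≡⟨ cong (S₂ +_) (∑<-*ˡ (suc p) 2 (λ i → tailCount (suc i))) ⟩
      S₂ + 2 * S₁ ∎
      where
      odd-suc : ∀ i x → (1 + 2 * suc i) * x ≡ (1 + 2 * i) * x + 2 * x
      odd-suc = solve-∀

  2+2p≡1+m : 2 * suc p ≡ suc m
  2+2p≡1+m = double-suc p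
    where
    double-suc : ∀ p → 2 * suc p ≡ suc (suc p + p)
    double-suc = solve-∀

  central-binomial : (2 * suc p) C suc p ≡ tailCount 0 + tailCount 0
  central-binomial = begin
    (2 * suc p) C suc p        ≡⟨ cong (_C suc p) 2+2p≡1+m ⟩
    suc m C suc p              ≡⟨ nCk+nC[k+1]≡[n+1]C[k+1] m p ⟨
    m C p + m C suc p          ≡⟨ cong (_+ m C suc p) (nCk≡nC[n∸k] (m≤n+m p (suc p))) ⟩
    m C (m ∸ p) + m C suc p    ≡⟨ cong (λ i → m C i + m C suc p) (m+n∸n≡m (suc p) p) ⟩
    tailCount 0 + tailCount 0  ∎

  N : ℕ
  N = pred (tailCount 0)

  tailCount0≡1+N : tailCount 0 ≡ suc N
  tailCount0≡1+N = sym (suc-pred (tailCount 0) {{>-nonZero (C-pos (m≤m+n (suc p) p))}})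

  #ordered : length (orderedPrefSets (suc p)) ≡ suc N
  #ordered = trans (length≡∑1 (orderedPrefSets (suc p))) (trans (∑-atLeast-flaws p 0) tailCount0≡1+N)

  power-sums-relation : suc N + S₂ + 2 * S₁ ≡ suc p * suc N
  power-sums-relation = subst (λ x → x + S₂ + 2 * S₁ ≡ suc p * x) tailCount0≡1+N telescoping

  ratio : (2 ^ (2 * suc p ∸ 1)) /ℕ ((2 * suc p) C suc p) ≡ (suc N + S₁) /ℕ suc N
  ratio = begin
    (2 ^ (2 * suc p ∸ 1)) /ℕ ((2 * suc p) C suc p)
      ≡⟨ cong₂ _/ℕ_ (trans (cong (λ e → 2 ^ (e ∸ 1)) 2+2p≡1+m) (sym halves))
                    (trans central-binomial (cong₂ _+_ tailCount0≡1+N tailCount0≡1+N)) ⟩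
    (suc N + S₁ + (suc N + S₁)) /ℕ (suc N + suc N)
      ≡⟨ /ℕ-double (suc N + S₁) N ⟩
    (suc N + S₁) /ℕ suc N ∎
    where
    halves : suc N + S₁ + (suc N + S₁) ≡ 2 ^ m
    halves = subst (λ x → x + S₁ + (x + S₁) ≡ 2 ^ m) tailCount0≡1+N
                   (trans (cong₂ _+_ tailCount0+S₁ tailCount0+S₁) ∑-upper-half)

mainTheorem18 : (n : ℕ) → 1 ≤ n →
    (mean (flawValues n) ≡ (2 ^ (2 * n ∸ 1)) /ℕ ((2 * n) C n) - 1ℚ)
    × (variance (flawValues n) ≡
         fromℕ n - ((2 ^ (2 * n ∸ 1)) /ℕ ((2 * n) C n)) *ℚ ((2 ^ (2 * n ∸ 1)) /ℕ ((2 * n) C n)))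
mainTheorem18 zero    ()
mainTheorem18 (suc p) _ =
  subst (λ Q → mean (flawValues (suc p)) ≡ Q - 1ℚ × variance (flawValues (suc p)) ≡ fromℕ (suc p) - Q *ℚ Q)
        (sym ratio)
        (Fractions.moments-from-power-sums (orderedPrefSets (suc p)) flaws (suc p) N S₁ S₂
                                           #ordered ∑-flaws ∑-flaws² power-sums-relation)
  where open FlawMoments p
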